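{- For all integers $b\ge 2$ and $\ell\ge 2$ there exist a word $w$ of length $\ell$ over the alphabet $\{1,2,\dots,b\}$ and a positive integer $y$ such that $\langle y^2\rangle_b = w\uparrow 2$.
   Context: For an integer $b\ge 2$, the bijective base-$b$ representation $\langle x\rangle_b$ of a positive integer $x$ is the unique word $a_1a_2\cdots a_k$ over the digit alphabet $\{1,2,\dots,b\}$ such that $x=\sum_{i=1}^k a_i b^{k-i}$. For a word $w$, $w\uparrow n$ denotes the concatenation of $n$ copies of $w$. -}

module Defs where

open import Data.Nat using (ℕ; zero; suc; _+_; _*_; _≤_)
open import Data.List using (List; []; _∷_; _++_; foldl)
open import Data.List.Relation.Unary.All using (All)
open import Data.Product using (_×_)
open import Relation.Binary.PropositionalEquality using (_≡_)

IsBijDigit : ℕ → ℕ → Set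
IsBijDigit b a = 1 ≤ a × a ≤ b

bijVal : ℕ → List ℕ → ℕ
bijVal b = foldl (λ acc a → acc * b + a) 0

-- ⟨ x ⟩_b ≡ w : w is the (unique) bijective base-b representation of x,
-- i.e. w is a word over {1,…,b} whose value is x.
IsBijRep : ℕ → ℕ → List ℕ → Set
IsBijRep b x w = All (IsBijDigit b) w × bijVal b w ≡ x

_↑_ : List ℕ → ℕ → List ℕ
w ↑ zero = []
w ↑ suc n = w ++ (w ↑ n)

{-# OPTIONS --safe #-}
-- With b ≥ 2 and ℓ = k + 2, the word w = (b−1)^k b 1 has value (b^k − 1)·b² + b·b + 1 = b^ℓ + 1
-- and length ℓ, so w w has value (b^ℓ + 1)·b^ℓ + (b^ℓ + 1) = (b^ℓ + 1)², a square.
module Submission where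

open import Defs
open import Data.Nat using (ℕ; _≤_; _*_; _+_; _^_; suc; zero; s≤s; z≤n)
open import Data.Nat.Properties using (≤-refl; n≤1+n; m≤n+m; +-comm)
open import Data.List using (List; length; []; _∷_; _++_; replicate; foldl)
open import Data.List.Properties using (foldl-++; length-++; length-replicate; ++-identityʳ)
open import Data.List.Relation.Unary.All using (All; []; _∷_)
open import Data.List.Relation.Unary.All.Properties using (++⁺; replicate⁺)
open import Data.Product using (Σ; _×_; _,_)
open import Relation.Binary.PropositionalEquality using (_≡_; refl; sym; trans; cong; module ≡-Reasoning)
open import Data.Nat.Solver using (module +-*-Solver)
open +-*-Solver using (solve; _:=_; _:+_; _:*_; con)

hornerStep : ℕ → ℕ → ℕ → ℕ
hornerStep b acc a = acc * b + a

foldl-hornerStep : ∀ b acc w → foldl (hornerStep b) acc w ≡ acc * b ^ length w + bijVal b w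
foldl-hornerStep b acc [] = solve 1 (λ a → a := a :* con 1 :+ con 0) refl acc
foldl-hornerStep b acc (a ∷ w)
  rewrite foldl-hornerStep b (acc * b + a) w | foldl-hornerStep b (0 * b + a) w =
  solve 5 (λ acc b a p v → (acc :* b :+ a) :* p :+ v := acc :* (b :* p) :+ ((con 0 :* b :+ a) :* p :+ v))
    refl acc b a (b ^ length w) (bijVal b w)

bijVal-++ : ∀ b u v → bijVal b (u ++ v) ≡ bijVal b u * b ^ length v + bijVal b v
bijVal-++ b u v = trans (foldl-++ (hornerStep b) 0 u v) (foldl-hornerStep b (bijVal b u) v)

bijVal-↑2 : ∀ b w → bijVal b (w ↑ 2) ≡ bijVal b w * b ^ length w + bijVal b w
bijVal-↑2 b w = trans (cong (λ v → bijVal b (w ++ v)) (++-identityʳ w)) (bijVal-++ b w w)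

bijVal-↑2-square : ∀ b w → bijVal b w ≡ b ^ length w + 1 →
  bijVal b (w ↑ 2) ≡ (b ^ length w + 1) * (b ^ length w + 1)
bijVal-↑2-square b w bijVal-w = begin
  bijVal b (w ↑ 2)                       ≡⟨ bijVal-↑2 b w ⟩
  bijVal b w * b ^ length w + bijVal b w ≡⟨ cong (λ v → v * P + v) bijVal-w ⟩
  (P + 1) * P + (P + 1)                  ≡⟨ solve 1 (λ p → (p :+ con 1) :* p :+ (p :+ con 1) := (p :+ con 1) :* (p :+ con 1)) refl P ⟩
  (P + 1) * (P + 1)                      ∎
  where
  open ≡-Reasoning
  P = b ^ length w

suc-bijVal-replicate-pred : ∀ c k → suc (bijVal (suc c) (replicate k c)) ≡ suc c ^ k
suc-bijVal-replicate-pred c zero = refl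
suc-bijVal-replicate-pred c (suc k) = begin
  suc (bijVal b (c ∷ replicate k c))          ≡⟨ cong suc (bijVal-++ b (c ∷ []) (replicate k c)) ⟩
  suc ((0 * b + c) * b ^ length rs + V)       ≡⟨ cong (λ n → suc (c * b ^ n + V)) (length-replicate k) ⟩
  suc (c * b ^ k + V)                         ≡⟨ solve 3 (λ c p v → con 1 :+ (c :* p :+ v) := (con 1 :+ v) :+ c :* p) refl c (b ^ k) V ⟩
  suc V + c * b ^ k                           ≡⟨ cong (_+ c * b ^ k) (suc-bijVal-replicate-pred c k) ⟩
  b ^ suc k                                   ∎
  where
  open ≡-Reasoning
  b = suc c
  rs = replicate k c
  V = bijVal b rs

squareHalf : ℕ → ℕ → List ℕ
squareHalf c k = replicate k c ++ suc c ∷ 1 ∷ []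

length-squareHalf : ∀ c k → length (squareHalf c k) ≡ 2 + k
length-squareHalf c k = begin
  length (squareHalf c k)    ≡⟨ length-++ (replicate k c) ⟩
  length (replicate k c) + 2 ≡⟨ cong (_+ 2) (length-replicate k) ⟩
  k + 2                      ≡⟨ +-comm k 2 ⟩
  2 + k                      ∎
  where open ≡-Reasoning

bijVal-squareHalf : ∀ c k → bijVal (suc c) (squareHalf c k) ≡ suc c ^ length (squareHalf c k) + 1
bijVal-squareHalf c k = begin
  bijVal b (replicate k c ++ b ∷ 1 ∷ [])   ≡⟨ bijVal-++ b (replicate k c) (b ∷ 1 ∷ []) ⟩
  V * b ^ 2 + ((0 * b + b) * b + 1)        ≡⟨ solve 2 (λ v b → v :* (b :* (b :* con 1)) :+ ((con 0 :* b :+ b) :* b :+ con 1)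
                                                        := (con 1 :+ v) :* (b :* (b :* con 1)) :+ con 1) refl V b ⟩
  suc V * b ^ 2 + 1                        ≡⟨ cong (λ n → n * b ^ 2 + 1) (suc-bijVal-replicate-pred c k) ⟩
  b ^ k * b ^ 2 + 1                        ≡⟨ solve 2 (λ p b → p :* (b :* (b :* con 1)) :+ con 1 := b :* (b :* p) :+ con 1) refl (b ^ k) b ⟩
  b ^ (2 + k) + 1                          ≡⟨ cong (λ n → b ^ n + 1) (sym (length-squareHalf c k)) ⟩
  b ^ length (squareHalf c k) + 1          ∎
  where
  open ≡-Reasoning
  b = suc c
  V = bijVal b (replicate k c)

squareHalf-digits : ∀ c k → 1 ≤ c → All (IsBijDigit (suc c)) (squareHalf c k)
squareHalf-digits c k 1≤c = ++⁺ (replicate⁺ k (1≤c , n≤1+n c)) ((s≤s z≤n , ≤-refl) ∷ (≤-refl , s≤s z≤n) ∷ [])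

mainTheorem15 : (b ℓ : ℕ) → 2 ≤ b → 2 ≤ ℓ →
    Σ (List ℕ) λ w → Σ ℕ λ y →
      length w ≡ ℓ × All (IsBijDigit b) w × 1 ≤ y × IsBijRep b (y * y) (w ↑ 2)
mainTheorem15 (suc zero) _ (s≤s ()) _
mainTheorem15 _ (suc zero) _ (s≤s ())
mainTheorem15 (suc (suc d)) (suc (suc k)) _ _ =
  w , b ^ length w + 1 , length-squareHalf (suc d) k , digits , m≤n+m 1 _ , ++⁺ digits (++⁺ digits []) ,
  bijVal-↑2-square b w (bijVal-squareHalf (suc d) k)
  where
  b = suc (suc d)
  w = squareHalf (suc d) k
  digits : All (IsBijDigit b) w
  digits = squareHalf-digits (suc d) k (s≤s z≤n)
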